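{- Let $A,B$ be finite alphabets, $\phi\colon A^*\to A^*$ a $k$-uniform morphism, $h\colon A\to B$ a coding and $s\in A$ such that $\phi$ is prolongable on $s$, and assume every symbol of $A$ occurs in $\phi^\infty(s)$. Then $h(\phi^\infty(s))$ is almost periodic if and only if for every $m\in\mathbb{N}$ the word $h(\phi^m(s))$ occurs in $h(\phi^\infty(s))$ infinitely often with bounded distances.
   Context: A morphism satisfies $\phi(uv)=\phi(u)\phi(v)$; it is $k$-uniform if $|\phi(a)|=k$ for all $a\in A$. A coding is a letter-to-letter map $h\colon A\to B$ extended letterwise to words and sequences. $\phi$ is prolongable on $s$ if $s$ is the first letter of $\phi(s)$ and $\phi^\infty(s)=\lim_m\phi^m(s)$ is infinite. A word occurs in a sequence infinitely often with bounded distances if it has infinitely many occurrences and the distances between consecutive occurrences are bounded. A sequence $x$ is almost periodic if for every factor $u$ of $x$ there is $l$ such that every factor of $x$ of length $l$ contains an occurrence of $u$. -}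

module Defs where

open import Data.Nat using (ℕ; zero; suc; _+_; _∸_; _≤_; _<_)
open import Data.Fin using (Fin)
open import Data.List using (List; []; _∷_; length; map; concatMap; upTo)
open import Data.Product using (Σ; ∃; ∃-syntax; _×_; _,_)
open import Relation.Binary.PropositionalEquality using (_≡_)
open import Relation.Nullary using (¬_)

Word : Set → Set
Word A = List A

Seq : Set → Set
Seq A = ℕ → A

-- A morphism A* → A* is determined by the images of the letters;
-- ext φ is its (unique) extension to words: φ(uv) = φ(u)φ(v).
ext : {A : Set} → (A → Word A) → Word A → Word A
ext φ w = concatMap φ w

iter : {A : Set} → (A → Word A) → ℕ → Word A → Word A
iter φ zero    w = w
iter φ (suc m) w = ext φ (iter φ m w)

Uniform : {A : Set} → ℕ → (A → Word A) → Set
Uniform k φ = ∀ a → length (φ a) ≡ k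

-- φ is prolongable on s: s is the first letter of φ(s), and the words φ^m(s)
-- have unbounded length (so φ^∞(s) is infinite).
Prolongable : {A : Set} → (A → Word A) → A → Set
Prolongable φ s =
  (Σ (Word _) λ w → φ s ≡ s ∷ w) ×
  (∀ n → ∃[ m ] n ≤ length (iter φ m (s ∷ [])))

factorAt : {A : Set} → Seq A → ℕ → ℕ → Word A
factorAt x i n = map (λ j → x (i + j)) (upTo n)

OccursAt : {A : Set} → Word A → Seq A → ℕ → Set
OccursAt u x i = factorAt x i (length u) ≡ u

IsPrefix : {A : Set} → Word A → Seq A → Set
IsPrefix u x = OccursAt u x 0

-- x = φ^∞(s): every φ^m(s) is a prefix of x (together with Prolongable, which
-- makes these prefixes unboundedly long, this determines x uniquely).
IsFixedPointLimit : {A : Set} → (A → Word A) → A → Seq A → Set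
IsFixedPointLimit φ s x = ∀ m → IsPrefix (iter φ m (s ∷ [])) x

Factor : {A : Set} → Word A → Seq A → Set
Factor u x = ∃[ i ] OccursAt u x i

AlmostPeriodic : {A : Set} → Seq A → Set
AlmostPeriodic x =
  ∀ u → Factor u x →
    ∃[ l ] ∀ i → ∃[ j ] (j + length u ≤ l × OccursAt u x (i + j))

InfOftenBounded : {A : Set} → Word A → Seq A → Set
InfOftenBounded u x =
  (∀ n → ∃[ i ] (n ≤ i × OccursAt u x i)) ×
  (∃[ d ] ∀ i i' → OccursAt u x i → OccursAt u x i' → i < i' →
      (∀ t → i < t → t < i' → ¬ OccursAt u x t) → i' ∸ i ≤ d)

-- A factor u = x[i₀, i₀ + |u|) lies inside every prefix w of length at least i₀ + |u|, and
-- it recurs wherever w does; so almost periodicity need only be tested on a family of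
-- arbitrarily long prefixes.  For a prefix w, occurring in every window of length l
-- bounds the gaps between consecutive occurrences by l + 1, and conversely bounded gaps
-- together with the occurrence at 0 place w in every window of bounded length.  Hence the
-- equivalence holds for every sequence with the prefixes h(φᵐ(s)).
module Submission where

open import Defs
open import Data.Nat using (ℕ; zero; suc; _+_; _∸_; _≤_; _<_; _<?_; z≤n; s≤s; s≤s⁻¹; z<s; s<s)
open import Data.Nat.Properties
open import Data.Fin using (Fin)
import Data.Fin.Properties as Fin
open import Data.List using (List; []; _∷_; map; length; applyUpTo; upTo)
open import Data.List.Properties using (map-upTo; length-map; map-∘; ≡-dec; ∷-injectiveˡ; ∷-injectiveʳ)
open import Data.Product using (∃-syntax; _×_; _,_; proj₂)
open import Data.Sum using (_⊎_; inj₁; inj₂)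
open import Data.Empty using (⊥-elim)
open import Relation.Binary.Definitions using (DecidableEquality)
open import Relation.Binary.PropositionalEquality
open import Relation.Nullary using (¬_; yes; no)
open import Relation.Unary using (Pred; Decidable)
open import Function using (_∘_)
open import Function.Bundles using (_⇔_; mk⇔)

OccursInEveryWindow : {A : Set} → ℕ → Word A → Seq A → Set
OccursInEveryWindow l u x = ∀ i → ∃[ j ] (j + length u ≤ l × OccursAt u x (i + j))

module _ {A : Set} where

  applyUpTo-cong : ∀ (f g : ℕ → A) n → (∀ j → j < n → f j ≡ g j) →
    applyUpTo f n ≡ applyUpTo g n
  applyUpTo-cong f g zero    f≈g = refl
  applyUpTo-cong f g (suc n) f≈g = cong₂ _∷_ (f≈g 0 z<s)
    (applyUpTo-cong (f ∘ suc) (g ∘ suc) n (λ j j<n → f≈g (suc j) (s<s j<n)))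

  applyUpTo-pointwise : ∀ (f g : ℕ → A) n → applyUpTo f n ≡ applyUpTo g n →
    ∀ j → j < n → f j ≡ g j
  applyUpTo-pointwise f g (suc n) eq zero    _         = ∷-injectiveˡ eq
  applyUpTo-pointwise f g (suc n) eq (suc j) (s≤s j<n) =
    applyUpTo-pointwise (f ∘ suc) (g ∘ suc) n (∷-injectiveʳ eq) j j<n

module _ {A : Set} (x : Seq A) where

  factorAt-cong : ∀ i i' n → (∀ j → j < n → x (i + j) ≡ x (i' + j)) →
    factorAt x i n ≡ factorAt x i' n
  factorAt-cong i i' n agree =
    trans (map-upTo _ n) (trans (applyUpTo-cong _ _ n agree) (sym (map-upTo _ n)))

  factorAt-pointwise : ∀ i i' n → factorAt x i n ≡ factorAt x i' n →
    ∀ j → j < n → x (i + j) ≡ x (i' + j)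
  factorAt-pointwise i i' n eq =
    applyUpTo-pointwise _ _ n (trans (sym (map-upTo _ n)) (trans eq (map-upTo _ n)))

  occursAt-inCopyOfPrefix : ∀ {w u : Word A} {q i} → IsPrefix w x → OccursAt w x q →
    OccursAt u x i → i + length u ≤ length w → OccursAt u x (q + i)
  occursAt-inCopyOfPrefix {w} {u} {q} {i} w-at-0 w-at-q u-at-i inside =
    trans (factorAt-cong (q + i) i (length u) agree) u-at-i
    where
    copy : ∀ j → j < length w → x (q + j) ≡ x j
    copy = factorAt-pointwise q 0 (length w) (trans w-at-q (sym w-at-0))
    agree : ∀ j → j < length u → x (q + i + j) ≡ x (i + j)
    agree j j<|u| =
      trans (cong x (+-assoc q i j)) (copy (i + j) (≤-trans (+-monoʳ-< i j<|u|) inside))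

occursAt-map : ∀ {A B : Set} (h : A → B) {w : Word A} {x : Seq A} {i} →
  OccursAt w x i → OccursAt (map h w) (h ∘ x) i
occursAt-map h {w} {x} {i} w-at-i = begin
  factorAt (h ∘ x) i (length (map h w))  ≡⟨ cong (factorAt (h ∘ x) i) (length-map h w) ⟩
  factorAt (h ∘ x) i (length w)          ≡⟨ map-∘ (upTo (length w)) ⟩
  map h (factorAt x i (length w))        ≡⟨ cong (map h) w-at-i ⟩
  map h w                                ∎
  where open ≡-Reasoning

module _ {p} {P : Pred ℕ p} (P? : Decidable P) where

  FirstAfter : ℕ → ℕ → Set p
  FirstAfter a q = a < q × P q × (∀ t → a < t → t < q → ¬ P t)

  search-upTo : ∀ a r → (∀ t → a < t → t ≤ r → ¬ P t) ⊎ ∃[ q ] (q ≤ r × FirstAfter a q)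
  search-upTo a zero = inj₁ λ t a<t t≤0 _ → <-irrefl refl (<-≤-trans a<t (≤-trans t≤0 z≤n))
  search-upTo a (suc r) with search-upTo a r
  ... | inj₂ (q , q≤r , first) = inj₂ (q , m≤n⇒m≤1+n q≤r , first)
  ... | inj₁ none with P? (suc r) | a <? suc r
  ...   | yes Pr | yes a<r =
            inj₂ (suc r , ≤-refl , a<r , Pr , λ t a<t t<r → none t a<t (s≤s⁻¹ t<r))
  ...   | yes _  | no a≮r  = inj₁ λ t a<t t≤r _ → a≮r (<-≤-trans a<t t≤r)
  ...   | no ¬Pr | _       = inj₁ λ t a<t t≤r → case a<t (m≤n⇒m<n∨m≡n t≤r)
    where
    case : ∀ {t} → a < t → t < suc r ⊎ t ≡ suc r → ¬ P t
    case a<t (inj₁ t<r)  = none _ a<t (s≤s⁻¹ t<r)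
    case _   (inj₂ refl) = ¬Pr

  firstAfter : ∀ {a r} → a < r → P r → ∃[ q ] (q ≤ r × FirstAfter a q)
  firstAfter {a} {r} a<r Pr with search-upTo a r
  ... | inj₁ none  = ⊥-elim (none r a<r ≤-refl Pr)
  ... | inj₂ first = first

boundedSteps⇒hitsEveryInterval : ∀ {p} {P : Pred ℕ p} d → P 0 →
  (∀ a → P a → ∃[ q ] (a < q × q ≤ a + d × P q)) →
  ∀ i → ∃[ q ] (i ≤ q × q ≤ i + d × P q)
boundedSteps⇒hitsEveryInterval d P0 step zero = 0 , z≤n , z≤n , P0
boundedSteps⇒hitsEveryInterval d P0 step (suc i)
  with boundedSteps⇒hitsEveryInterval d P0 step i
... | q , i≤q , q≤i+d , Pq with m≤n⇒m<n∨m≡n i≤q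
...   | inj₁ i<q  = q , i<q , m≤n⇒m≤1+n q≤i+d , Pq
...   | inj₂ refl with step q Pq
...     | q' , q<q' , q'≤q+d , Pq' = q' , q<q' , m≤n⇒m≤1+n q'≤q+d , Pq'

module _ {A : Set} {u : Word A} {x : Seq A} where

  occursInEveryWindow⇒infOftenBounded : ∀ {l} → OccursInEveryWindow l u x → InfOftenBounded u x
  occursInEveryWindow⇒infOftenBounded {l} window = infinitely , suc l , gap
    where
    infinitely : ∀ n → ∃[ i ] (n ≤ i × OccursAt u x i)
    infinitely n with window n
    ... | j , _ , u-at-n+j = n + j , m≤m+n n j , u-at-n+j

    gap : ∀ i i' → OccursAt u x i → OccursAt u x i' → i < i' →
      (∀ t → i < t → t < i' → ¬ OccursAt u x t) → i' ∸ i ≤ suc l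
    gap i i' _ _ _ noneBetween with window (suc i)
    ... | j , j+|u|≤l , u-at-1+i+j with suc i + j <? i'
    ...   | yes between = ⊥-elim (noneBetween (suc i + j) (s≤s (m≤m+n i j)) between u-at-1+i+j)
    ...   | no notBefore = m≤n+o⇒m∸n≤o i' i (begin
            i'          ≤⟨ ≮⇒≥ notBefore ⟩
            suc i + j   ≡⟨ +-suc i j ⟨
            i + suc j   ≤⟨ +-monoʳ-≤ i (s≤s (≤-trans (m≤m+n j _) j+|u|≤l)) ⟩
            i + suc l   ∎)
      where open ≤-Reasoning

  -- Bounded gaps only constrain consecutive occurrences, so the next occurrence after a
  -- has to be located by a search, which needs decidable equality of letters.
  infOftenBounded⇒boundedSteps : DecidableEquality A → InfOftenBounded u x →
    ∃[ d ] ∀ a → OccursAt u x a → ∃[ q ] (a < q × q ≤ a + d × OccursAt u x q)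
  infOftenBounded⇒boundedSteps _≟_ (infinitely , d , gap) = d , step
    where
    step : ∀ a → OccursAt u x a → ∃[ q ] (a < q × q ≤ a + d × OccursAt u x q)
    step a u-at-a with infinitely (suc a)
    ... | r , a<r , u-at-r
      with firstAfter (λ t → ≡-dec _≟_ (factorAt x t (length u)) u) a<r u-at-r
    ...   | q , _ , a<q , u-at-q , noneBetween = q , a<q , q≤a+d , u-at-q
      where
      q≤a+d : q ≤ a + d
      q≤a+d = ≤-trans (m≤n+m∸n q a)
        (+-monoʳ-≤ a (gap a q u-at-a u-at-q a<q noneBetween))

module _ {A : Set} {w : Word A} {x : Seq A} (w-prefix : IsPrefix w x) where

  infOftenBounded⇒occursInEveryWindow : DecidableEquality A → InfOftenBounded w x →
    ∃[ l ] OccursInEveryWindow l w x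
  infOftenBounded⇒occursInEveryWindow _≟_ bounded with infOftenBounded⇒boundedSteps _≟_ bounded
  ... | d , step = d + length w , window
    where
    window : OccursInEveryWindow (d + length w) w x
    window i with boundedSteps⇒hitsEveryInterval d w-prefix step i
    ... | q , i≤q , q≤i+d , w-at-q =
      q ∸ i , +-monoˡ-≤ (length w) (m≤n+o⇒m∸n≤o q i q≤i+d) ,
      subst (OccursAt w x) (sym (m+[n∸m]≡n i≤q)) w-at-q

  occursInEveryWindow-factorOfPrefix : ∀ {l} {u : Word A} {i₀} → OccursInEveryWindow l w x →
    OccursAt u x i₀ → i₀ + length u ≤ length w → OccursInEveryWindow l u x
  occursInEveryWindow-factorOfPrefix {l} {u} {i₀} window u-at-i₀ inside i with window i
  ... | j , j+|w|≤l , w-at-i+j =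
    j + i₀ ,
    ≤-trans (≤-reflexive (+-assoc j i₀ (length u))) (≤-trans (+-monoʳ-≤ j inside) j+|w|≤l) ,
    subst (OccursAt u x) (+-assoc i j i₀)
      (occursAt-inCopyOfPrefix x w-prefix w-at-i+j u-at-i₀ inside)

almostPeriodic⇔prefixesInfOftenBounded : ∀ {A : Set} → DecidableEquality A →
  (x : Seq A) (w : ℕ → Word A) → (∀ m → IsPrefix (w m) x) →
  (∀ n → ∃[ m ] n ≤ length (w m)) →
  AlmostPeriodic x ⇔ (∀ m → InfOftenBounded (w m) x)
almostPeriodic⇔prefixesInfOftenBounded _≟_ x w prefix long = mk⇔ to from
  where
  to : AlmostPeriodic x → ∀ m → InfOftenBounded (w m) x
  to ap m = occursInEveryWindow⇒infOftenBounded {x = x} (proj₂ (ap (w m) (0 , prefix m)))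

  from : (∀ m → InfOftenBounded (w m) x) → AlmostPeriodic x
  from bounded u (i₀ , u-at-i₀) with long (i₀ + length u)
  ... | m , inside with infOftenBounded⇒occursInEveryWindow (prefix m) _≟_ (bounded m)
  ...   | l , window = l , occursInEveryWindow-factorOfPrefix (prefix m) window u-at-i₀ inside

proposition2 : (na nb k : ℕ) (φ : Fin na → List (Fin na)) (h : Fin na → Fin nb)
    (s : Fin na) (x : ℕ → Fin na) →
    Uniform k φ → Prolongable φ s → IsFixedPointLimit φ s x →
    (∀ a → ∃[ i ] x i ≡ a) →
    AlmostPeriodic (h ∘ x) ⇔ (∀ m → InfOftenBounded (map h (iter φ m (s ∷ []))) (h ∘ x))
proposition2 na nb k φ h s x _ (_ , unbounded) fixedPoint _ =
  almostPeriodic⇔prefixesInfOftenBounded Fin._≟_ (h ∘ x) (map h ∘ φᵐs)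
    (λ m → occursAt-map h {x = x} (fixedPoint m)) long
  where
  φᵐs : ℕ → List (Fin na)
  φᵐs m = iter φ m (s ∷ [])

  long : ∀ n → ∃[ m ] n ≤ length (map h (φᵐs m))
  long n with unbounded n
  ... | m , n≤|φᵐs| = m , ≤-trans n≤|φᵐs| (≤-reflexive (sym (length-map h (φᵐs m))))
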